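{- Let $s\in\mathbb{N}$ and let $\mathcal{S}$ be a signature consisting of exactly $s$ elements, all of arity $1$. Then the natural Hopf algebra $\mathbf{N}(\mathsf{MAs}_{\mathcal{S}})$ is isomorphic to the Hopf algebra $\mathbf{Sym}^{(s)}$ of noncommutative multi-symmetric functions of level $s$.
   Context: For an operad $\mathcal{O}$ (nonsymmetric) which is finitely factorizable (each element has finitely many factorizations $x=y[z_1,\dots,z_{\mathrm{ar}(y)}]$) with grading $\mathrm{dg}$ ($\mathrm{dg}^{ -1}(0)=\{\mathds{1}\}$, $\mathrm{dg}$ additive under composition), the natural Hopf algebra $\mathbf{N}(\mathcal{O})$ over a field $\mathbb{K}$ of characteristic $0$ has basis $\mathsf{E}_w$ indexed by words $w$ on $\mathcal{O}$ with no letter equal to the unit $\mathds{1}$, product $\mathsf{E}_w\mathsf{E}_{w'}=\mathsf{E}_{ww'}$, and coproduct the algebra morphism with $\Delta\mathsf{E}_x=\sum_{y\in\mathcal{O}}\sum_{w\in\mathcal{O}^{\mathrm{ar}(y)}}[x=y[w_1,\dots,w_{\mathrm{ar}(y)}]]\,\mathsf{E}_{\mathrm{rd}(y)}\otimes\mathsf{E}_{\mathrm{rd}(w)}$ for $x\in\mathcal{O}$, where $\mathrm{rd}$ deletes letters equal to $\mathds{1}$. $\mathsf{MAs}_{\mathcal{S}}$ is the quotient of the free operad $\mathfrak{T}(\mathcal{S})$ (planar rooted trees with internal nodes decorated by $\mathcal{S}$, composition by grafting, grading = number of internal nodes) by the operad congruence generated by $\mathsf{g}\circ_i\mathsf{g}'\equiv\mathsf{g}'\circ_{i'}\mathsf{g}$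 for all $\mathsf{g},\mathsf{g}'\in\mathcal{S}$, $i\in[\mathrm{ar}(\mathsf{g})]$, $i'\in[\mathrm{ar}(\mathsf{g}')]$, graded by the number of internal nodes. $\mathbf{Sym}^{(s)}$ is the free associative algebra over $\mathbb{K}$ on generators $S_v$, $v\in\mathbb{N}^s\setminus\{0\}$ (with $S_0:=1$), graded by $|v|=v_1+\dots+v_s$, with coproduct the algebra morphism $\Delta S_v=\sum_{v'+v''=v}S_{v'}\otimes S_{v''}$ (componentwise sum of vectors in $\mathbb{N}^s$). -}

module Defs where

open import Level using (Level; _⊔_; 0ℓ)
open import Data.Nat using (ℕ; zero; suc; _∸_) renaming (_+_ to _+ℕ_)
open import Data.Nat.Properties using (_≟_)
open import Data.Fin using (Fin)
open import Data.Vec using (Vec; []; _∷_; replicate)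
import Data.Vec.Properties as VecP
open import Data.List using (List; []; _∷_; _++_; map; concatMap; upTo)
open import Data.Product using (Σ; _×_; _,_; proj₁; proj₂; ∃)
open import Data.Empty using (⊥)
open import Relation.Nullary using (¬_; yes; no)
open import Relation.Binary.PropositionalEquality using (_≡_; _≢_; refl; cong)
import Relation.Binary.PropositionalEquality.Properties as ≡P
open import Relation.Binary.Bundles using (Setoid)
import Relation.Binary.Construct.On as On
import Data.List.Relation.Binary.Pointwise as LPW
open import Data.Product.Relation.Binary.Pointwise.NonDependent using (×-setoid)
open import Algebra.Bundles using (CommutativeRing)
open import Data.List.Relation.Unary.Any using (Any)
open import Data.List.Relation.Unary.All using (All)
open import Data.List.Relation.Unary.AllPairs using (AllPairs)

module _ {c ℓ} (K : CommutativeRing c ℓ) where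
  open CommutativeRing K

  IsField : Set (c ⊔ ℓ)
  IsField = (¬ (0# ≈ 1#)) × (∀ x → ¬ (x ≈ 0#) → ∃ λ y → (x * y) ≈ 1#)

  natK : ℕ → Carrier
  natK zero = 0#
  natK (suc n) = 1# + natK n

  CharZero : Set ℓ
  CharZero = ∀ n → natK n ≈ 0# → n ≡ 0

module Ops {c ℓ} (K : CommutativeRing c ℓ) where
  open CommutativeRing K

  Lin : Set → Set c
  Lin X = List (Carrier × X)

  single : ∀ {X} → X → Lin X
  single x = (1# , x) ∷ []

  scale : ∀ {X} → Carrier → Lin X → Lin X
  scale a = map (λ p → (a * proj₁ p , proj₂ p))

  ext : ∀ {X Y} → (X → Lin Y) → Lin X → Lin Y
  ext f [] = []
  ext f ((a , x) ∷ u) = scale a (f x) ++ ext f u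

  bil : ∀ {X Y Z} → (X → Y → Z) → Lin X → Lin Y → Lin Z
  bil f u v = ext (λ x → ext (λ y → single (f x y)) v) u

  eval : ∀ {X} → (X → Carrier) → Lin X → Carrier
  eval f [] = 0#
  eval f ((a , x) ∷ u) = (a * f x) + eval f u

-- Equality in the free K-module on a basis setoid B:
-- formal sums modulo reordering, merging of equal basis elements,
-- removal of zero coefficients, and congruence.

module FreeMod {c ℓ} (K : CommutativeRing c ℓ) (B : Setoid 0ℓ 0ℓ) where
  open CommutativeRing K using (Carrier; _+_; 0#) renaming (_≈_ to _≈K_)
  open Setoid B using () renaming (Carrier to Bas; _≈_ to _≈B_)
  open Ops K

  infix 4 _∼_
  data _∼_ : Lin Bas → Lin Bas → Set (c ⊔ ℓ) where
    ∼refl  : ∀ {u} → u ∼ u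
    ∼sym   : ∀ {u v} → u ∼ v → v ∼ u
    ∼trans : ∀ {u v w} → u ∼ v → v ∼ w → u ∼ w
    ∼cons  : ∀ {a a' b b' u u'} → a ≈K a' → b ≈B b' → u ∼ u' →
             ((a , b) ∷ u) ∼ ((a' , b') ∷ u')
    ∼swap  : ∀ {x y u} → (x ∷ y ∷ u) ∼ (y ∷ x ∷ u)
    ∼merge : ∀ {a a' b u} → ((a , b) ∷ (a' , b) ∷ u) ∼ ((a + a' , b) ∷ u)
    ∼zero  : ∀ {b u} → ((0# , b) ∷ u) ∼ u

-- "Word" bialgebras: the free associative algebra with basis the words
-- on a setoid G of generators (product = concatenation, unit = empty word),
-- with coproduct the algebra morphism determined by its values δ on the
-- generators (the tensor square having basis pairs of words), and counit
-- ε(E_[]) = 1, ε(E_w) = 0 otherwise.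

module WordBialg {c ℓ} (K : CommutativeRing c ℓ) (G : Setoid 0ℓ 0ℓ) where
  open CommutativeRing K using (Carrier; 0#; 1#)
  open Ops K

  Gen : Set
  Gen = Setoid.Carrier G

  WordS : Setoid 0ℓ 0ℓ
  WordS = LPW.setoid G

  Word : Set
  Word = List Gen

  Word²S : Setoid 0ℓ 0ℓ
  Word²S = ×-setoid WordS WordS

  Coproduct : Set c
  Coproduct = Gen → Lin (Word × Word)

  mul : Lin Word → Lin Word → Lin Word
  mul = bil _++_

  mul⊗ : Lin (Word × Word) → Lin (Word × Word) → Lin (Word × Word)
  mul⊗ = bil (λ p q → (proj₁ p ++ proj₁ q , proj₂ p ++ proj₂ q))

  Δ : Coproduct → Word → Lin (Word × Word)
  Δ δ [] = single ([] , [])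
  Δ δ (g ∷ w) = mul⊗ (δ g) (Δ δ w)

  ε : Word → Carrier
  ε [] = 1#
  ε (_ ∷ _) = 0#

-- Isomorphism of bialgebras (hence of Hopf algebras) between two word
-- bialgebras, given by linear maps defined on bases.
module _ {c ℓ} (K : CommutativeRing c ℓ) where
  open CommutativeRing K using () renaming (_≈_ to _≈K_)
  open Ops K

  record BialgIso (G₁ : Setoid 0ℓ 0ℓ) (δ₁ : WordBialg.Coproduct K G₁)
                  (G₂ : Setoid 0ℓ 0ℓ) (δ₂ : WordBialg.Coproduct K G₂) : Set (c ⊔ ℓ) where
    module A = WordBialg K G₁
    module B = WordBialg K G₂
    open FreeMod K A.WordS renaming (_∼_ to _∼A_)
    open FreeMod K B.WordS renaming (_∼_ to _∼B_)
    open FreeMod K B.Word²S renaming (_∼_ to _∼B⊗_)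
    field
      φ : A.Word → Lin B.Word
      ψ : B.Word → Lin A.Word
      φ-resp : ∀ {w w'} → Setoid._≈_ A.WordS w w' → φ w ∼B φ w'
      ψ-resp : ∀ {w w'} → Setoid._≈_ B.WordS w w' → ψ w ∼A ψ w'
      ψ∘φ : ∀ w → ext ψ (φ w) ∼A single w
      φ∘ψ : ∀ w → ext φ (ψ w) ∼B single w
      φ-unit : φ [] ∼B single []
      φ-mul : ∀ w w' → φ (w ++ w') ∼B B.mul (φ w) (φ w')
      φ-Δ : ∀ w → ext (λ p → bil _,_ (φ (proj₁ p)) (φ (proj₂ p))) (A.Δ δ₁ w)
                  ∼B⊗ ext (B.Δ δ₂) (φ w)
      φ-ε : ∀ w → eval B.ε (φ w) ≈K A.ε w

-- Free operad T(S): planar rooted trees whose internal nodes (all of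
-- arity 1) are decorated by S; composition = grafting on the unique leaf.

data UTree (s : ℕ) : Set where
  leaf : UTree s
  node : Fin s → UTree s → UTree s

module _ {s : ℕ} where
  graft : UTree s → UTree s → UTree s
  graft leaf z = z
  graft (node g y) z = node g (graft y z)

  deg : UTree s → ℕ
  deg leaf = 0
  deg (node g t) = suc (deg t)

  infix 4 _≈M_
  data _≈M_ : UTree s → UTree s → Set where
    m-refl  : ∀ {x} → x ≈M x
    m-sym   : ∀ {x y} → x ≈M y → y ≈M x
    m-trans : ∀ {x y z} → x ≈M y → y ≈M z → x ≈M z
    m-comp  : ∀ {x x' z z'} → x ≈M x' → z ≈M z' → graft x z ≈M graft x' z'
    m-gen   : ∀ g g' → graft (node g leaf) (node g' leaf) ≈M graft (node g' leaf) (node g leaf)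

MAs : ℕ → Setoid 0ℓ 0ℓ
MAs s = record { Carrier = UTree s ; _≈_ = _≈M_
               ; isEquivalence = record { refl = m-refl ; sym = m-sym ; trans = m-trans } }

module _ {s : ℕ} where
  private
    deg-graft : ∀ (x z : UTree s) → deg (graft x z) ≡ deg x +ℕ deg z
    deg-graft leaf z = refl
    deg-graft (node g x) z = cong suc (deg-graft x z)

  deg-resp : ∀ {x y : UTree s} → x ≈M y → deg x ≡ deg y
  deg-resp m-refl = refl
  deg-resp (m-sym p) = Relation.Binary.PropositionalEquality.sym (deg-resp p)
  deg-resp (m-trans p q) = Relation.Binary.PropositionalEquality.trans (deg-resp p) (deg-resp q)
  deg-resp (m-comp {x} {x'} {z} {z'} p q) =
    Relation.Binary.PropositionalEquality.trans (deg-graft x z)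
      (Relation.Binary.PropositionalEquality.trans
        (Relation.Binary.PropositionalEquality.cong₂ _+ℕ_ (deg-resp p) (deg-resp q))
        (Relation.Binary.PropositionalEquality.sym (deg-graft x' z')))
  deg-resp (m-gen g g') = refl

  node≉leaf : ∀ {g : Fin s} {t : UTree s} → ¬ (node g t ≈M leaf)
  node≉leaf p with deg-resp p
  ... | ()

-- Elements of MAs_S different from the unit (generators of N(MAs_S))
NGenCarrier : ℕ → Set
NGenCarrier s = Σ (UTree s) (λ t → ¬ (t ≈M leaf))

NGen : ℕ → Setoid 0ℓ 0ℓ
NGen s = On.setoid (MAs s) (proj₁ {B = λ t → ¬ (t ≈M leaf)})

rdM : ∀ {s} → UTree s → List (NGenCarrier s)
rdM leaf = []
rdM (node g t) = (node g t , node≉leaf) ∷ []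

record FactEnum {s : ℕ} (x : UTree s) : Set where
  field
    facts    : List (UTree s × UTree s)
    sound    : All (λ p → graft (proj₁ p) (proj₂ p) ≈M x) facts
    complete : ∀ y z → graft y z ≈M x →
               Any (λ p → (y ≈M proj₁ p) × (z ≈M proj₂ p)) facts
    distinct : AllPairs (λ p q → ¬ ((proj₁ p ≈M proj₁ q) × (proj₂ p ≈M proj₂ q))) facts

FinitelyFactorizable : ℕ → Set
FinitelyFactorizable s = (x : UTree s) → FactEnum x

δN : ∀ {c ℓ} (K : CommutativeRing c ℓ) (s : ℕ) → FinitelyFactorizable s →
     WordBialg.Coproduct K (NGen s)
δN K s fac x =
  map (λ p → (CommutativeRing.1# K , (rdM (proj₁ p) , rdM (proj₂ p))))
      (FactEnum.facts (fac (proj₁ x)))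

zeroV : (s : ℕ) → Vec ℕ s
zeroV s = replicate s 0

SGenCarrier : ℕ → Set
SGenCarrier s = Σ (Vec ℕ s) (λ v → v ≢ zeroV s)

SGen : ℕ → Setoid 0ℓ 0ℓ
SGen s = On.setoid (≡P.setoid (Vec ℕ s)) (proj₁ {B = λ v → v ≢ zeroV s})

splitsN : ℕ → List (ℕ × ℕ)
splitsN n = map (λ i → (i , n ∸ i)) (upTo (suc n))

splitsV : ∀ {s} → Vec ℕ s → List (Vec ℕ s × Vec ℕ s)
splitsV [] = ([] , []) ∷ []
splitsV (n ∷ v) =
  concatMap (λ ij → map (λ ab → (proj₁ ij ∷ proj₁ ab , proj₂ ij ∷ proj₂ ab)) (splitsV v))
            (splitsN n)

-- S_0 = 1 (empty word), S_v a one-letter word otherwise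
rdV : ∀ {s} → Vec ℕ s → List (SGenCarrier s)
rdV {s} v with VecP.≡-dec _≟_ v (zeroV s)
... | yes _ = []
... | no p = (v , p) ∷ []

δS : ∀ {c ℓ} (K : CommutativeRing c ℓ) (s : ℕ) → WordBialg.Coproduct K (SGen s)
δS K s v =
  map (λ p → (CommutativeRing.1# K , (rdV (proj₁ p) , rdV (proj₂ p)))) (splitsV (proj₁ v))

-- Node labels of MAs_S commute, so an element of MAs_S is determined by how
-- many of its nodes carry each label: the multiplicity vector is an
-- isomorphism of monoids from (MAs_S, grafting) onto (ℕ^s, +).  Hence the
-- factorizations x = y[z] correspond exactly to the decompositions
-- v' + v'' = v of the multiplicity vector v of x, which index the coproduct
-- of S_v.  A bijection between the generators of two word bialgebras that
-- intertwines their coproducts on generators extends letterwise to an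
-- isomorphism of bialgebras, and N(MAs_S) ≅ Sym^(s) is the instance given
-- by the multiplicity vector.

module Submission where

open import Defs
open import Level using (0ℓ; _⊔_)
open import Algebra.Bundles using (CommutativeRing)
open import Relation.Binary.Bundles using (Setoid)
open import Function using (_∘_)
open import Function.Bundles using (Inverse; mk⇔)
open import Data.Nat using (ℕ; zero; suc; s≤s; _≟_)
open import Data.Nat.Properties using (+-identityˡ; m+n∸m≡n; m+[n∸m]≡n; m≤m+n; ≤-pred)
open import Data.Fin using (Fin; zero; suc) renaming (_≟_ to _≟ᶠ_)
open import Data.Vec using (Vec; []; _∷_; zipWith; updateAt)
open import Data.Vec.Properties using (zipWith-identityˡ; updateAt-commutes; ∷-injective; ≡-dec)
open import Data.List using (List; []; _∷_; _++_; map; concatMap; cartesianProductWith)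
open import Data.List.Properties using (map-++; map-∘; ++-identityʳ)
open import Data.Product using (_×_; _,_; proj₁; proj₂; map₂)
open import Data.Empty using (⊥-elim)
open import Relation.Nullary using (yes; no)
open import Relation.Binary.PropositionalEquality as ≡ using (_≡_; cong; cong₂; subst)
import Data.List.Relation.Binary.Pointwise as Pointwise
open import Data.List.Relation.Binary.Permutation.Propositional as ↭ using (_↭_)
open import Data.List.Relation.Binary.Permutation.Propositional.Properties as ↭ using (shift; shifts)
open import Data.List.Relation.Binary.BagAndSetEquality using (∼bag⇒↭)
open import Data.List.Membership.Propositional using (_∈_)
open import Data.List.Membership.Propositional.Properties
  using (∈-map⁺; ∈-map⁻; ∈-upTo⁺; ∈-upTo⁻; ∈-cartesianProductWith⁺; ∈-cartesianProductWith⁻)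
open import Data.List.Membership.Propositional.Properties.WithK using (unique∧set⇒bag)
import Data.List.Relation.Unary.Any as Any
import Data.List.Relation.Unary.Any.Properties as Any
import Data.List.Relation.Unary.All as All
import Data.List.Relation.Unary.AllPairs as AllPairs
import Data.List.Relation.Unary.AllPairs.Properties as AllPairs
open import Data.List.Relation.Unary.Unique.Propositional using (Unique)
import Data.List.Relation.Unary.Unique.Propositional.Properties as Unique

module FreeModProperties {c ℓ} (K : CommutativeRing c ℓ) (B : Setoid 0ℓ 0ℓ) where
  open CommutativeRing K
  open Ops K
  open FreeMod K B
  open Setoid B using () renaming (Carrier to Basis; _≈_ to _≈B_; refl to ≈B-refl)

  ∼-setoid : Setoid c (c ⊔ ℓ)
  ∼-setoid = record
    { Carrier = Lin Basis ; _≈_ = _∼_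
    ; isEquivalence = record { refl = ∼refl ; sym = ∼sym ; trans = ∼trans } }

  ∼-prep : ∀ {a a' b} {u u' : Lin Basis} → a ≈ a' → u ∼ u' → ((a , b) ∷ u) ∼ ((a' , b) ∷ u')
  ∼-prep a≈a' = ∼cons a≈a' ≈B-refl

  single-cong : ∀ {b b'} → b ≈B b' → single b ∼ single b'
  single-cong b≈b' = ∼cons refl b≈b' ∼refl

  ↭⇒∼ : ∀ {u v : Lin Basis} → u ↭ v → u ∼ v
  ↭⇒∼ ↭.refl = ∼refl
  ↭⇒∼ (↭.prep _ p) = ∼-prep refl (↭⇒∼ p)
  ↭⇒∼ (↭.swap _ _ p) = ∼trans ∼swap (∼-prep refl (∼-prep refl (↭⇒∼ p)))
  ↭⇒∼ (↭.trans p q) = ∼trans (↭⇒∼ p) (↭⇒∼ q)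

  ++⁺ˡ : ∀ {u u'} w → u ∼ u' → (u ++ w) ∼ (u' ++ w)
  ++⁺ˡ w ∼refl = ∼refl
  ++⁺ˡ w (∼sym p) = ∼sym (++⁺ˡ w p)
  ++⁺ˡ w (∼trans p q) = ∼trans (++⁺ˡ w p) (++⁺ˡ w q)
  ++⁺ˡ w (∼cons a≈a' b≈b' p) = ∼cons a≈a' b≈b' (++⁺ˡ w p)
  ++⁺ˡ w ∼swap = ∼swap
  ++⁺ˡ w ∼merge = ∼merge
  ++⁺ˡ w ∼zero = ∼zero

  ++⁺ʳ : ∀ u {w w'} → w ∼ w' → (u ++ w) ∼ (u ++ w')
  ++⁺ʳ [] p = p
  ++⁺ʳ (_ ∷ u) p = ∼cons refl ≈B-refl (++⁺ʳ u p)

  ++⁺ : ∀ {u u' w w'} → u ∼ u' → w ∼ w' → (u ++ w) ∼ (u' ++ w')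
  ++⁺ {u' = u'} {w} p q = ∼trans (++⁺ˡ w p) (++⁺ʳ u' q)

  scale-cong : ∀ a {u u'} → u ∼ u' → scale a u ∼ scale a u'
  scale-cong a ∼refl = ∼refl
  scale-cong a (∼sym p) = ∼sym (scale-cong a p)
  scale-cong a (∼trans p q) = ∼trans (scale-cong a p) (scale-cong a q)
  scale-cong a (∼cons a≈a' b≈b' p) = ∼cons (*-congˡ a≈a') b≈b' (scale-cong a p)
  scale-cong a ∼swap = ∼swap
  scale-cong a ∼merge = ∼trans ∼merge (∼-prep (sym (distribˡ a _ _)) ∼refl)
  scale-cong a ∼zero = ∼trans (∼-prep (zeroʳ a) ∼refl) ∼zero

  scale-congˡ : ∀ {a a'} → a ≈ a' → ∀ u → scale a u ∼ scale a' u
  scale-congˡ a≈a' [] = ∼refl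
  scale-congˡ a≈a' (_ ∷ u) = ∼-prep (*-congʳ a≈a') (scale-congˡ a≈a' u)

  scale-identityˡ : ∀ u → scale 1# u ∼ u
  scale-identityˡ [] = ∼refl
  scale-identityˡ (_ ∷ u) = ∼-prep (*-identityˡ _) (scale-identityˡ u)

  scale-zeroˡ-++ : ∀ u w → (scale 0# u ++ w) ∼ w
  scale-zeroˡ-++ [] w = ∼refl
  scale-zeroˡ-++ (_ ∷ u) w = ∼trans (∼-prep (zeroˡ _) ∼refl) (∼trans ∼zero (scale-zeroˡ-++ u w))

  scale-distribʳ-++ : ∀ a a' u w → (scale a u ++ (scale a' u ++ w)) ∼ (scale (a + a') u ++ w)
  scale-distribʳ-++ a a' [] w = ∼refl
  scale-distribʳ-++ a a' ((x , b) ∷ u) w =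
    ∼trans (∼-prep refl (↭⇒∼ (shift (a' * x , b) (scale a u) (scale a' u ++ w))))
      (∼trans ∼merge (∼-prep (sym (distribʳ x a a')) (scale-distribʳ-++ a a' u w)))

module LinearExtension {c ℓ} (K : CommutativeRing c ℓ) (X Y : Setoid 0ℓ 0ℓ) where
  open Ops K
  module ∼X = FreeMod K X
  open ∼X using () renaming (_∼_ to _∼X_)
  open FreeMod K Y
  open FreeModProperties K Y
  open Setoid X using () renaming (Carrier to BX; _≈_ to _≈X_)
  open Setoid Y using () renaming (Carrier to BY)

  ext-congˡ : ∀ {f g : BX → Lin BY} → (∀ x → f x ∼ g x) → ∀ u → ext f u ∼ ext g u
  ext-congˡ f∼g [] = ∼refl
  ext-congˡ f∼g ((a , x) ∷ u) = ++⁺ (scale-cong a (f∼g x)) (ext-congˡ f∼g u)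

  ext-congʳ : ∀ {f : BX → Lin BY} → (∀ {x x'} → x ≈X x' → f x ∼ f x') →
              ∀ {u u'} → u ∼X u' → ext f u ∼ ext f u'
  ext-congʳ f-cong ∼X.∼refl = ∼refl
  ext-congʳ f-cong (∼X.∼sym p) = ∼sym (ext-congʳ f-cong p)
  ext-congʳ f-cong (∼X.∼trans p q) = ∼trans (ext-congʳ f-cong p) (ext-congʳ f-cong q)
  ext-congʳ {f} f-cong (∼X.∼cons {a} {a'} {b} a≈a' b≈b' p) =
    ++⁺ (∼trans (scale-congˡ a≈a' (f b)) (scale-cong a' (f-cong b≈b'))) (ext-congʳ f-cong p)
  ext-congʳ {f} f-cong (∼X.∼swap {a , b} {a' , b'}) = ↭⇒∼ (shifts (scale a (f b)) (scale a' (f b')))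
  ext-congʳ {f} f-cong (∼X.∼merge {a} {a'} {b} {u}) = scale-distribʳ-++ a a' (f b) (ext f u)
  ext-congʳ {f} f-cong (∼X.∼zero {b} {u}) = scale-zeroˡ-++ (f b) (ext f u)

module BilinearExtension {c ℓ} (K : CommutativeRing c ℓ) (X Y Z : Setoid 0ℓ 0ℓ) where
  open Ops K
  open FreeMod K X using () renaming (_∼_ to _∼X_)
  open FreeMod K Y using () renaming (_∼_ to _∼Y_)
  open FreeMod K Z
  open FreeModProperties K Z using (single-cong)
  module XZ = LinearExtension K X Z
  module YZ = LinearExtension K Y Z
  module X = Setoid X
  module Y = Setoid Y
  module Z = Setoid Z

  bil-cong : ∀ {f : X.Carrier → Y.Carrier → Z.Carrier} →
             (∀ {x x' y y'} → x X.≈ x' → y Y.≈ y' → f x y Z.≈ f x' y') →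
             ∀ {u u' v v'} → u ∼X u' → v ∼Y v' → bil f u v ∼ bil f u' v'
  bil-cong f-cong {u' = u'} {v} u∼u' v∼v' =
    ∼trans (XZ.ext-congʳ (λ x≈x' → YZ.ext-congˡ (λ _ → single-cong (f-cong x≈x' Y.refl)) v) u∼u')
           (XZ.ext-congˡ (λ _ → YZ.ext-congʳ (λ y≈y' → single-cong (f-cong X.refl y≈y')) v∼v') u')

module Rebasing {c ℓ} (K : CommutativeRing c ℓ) where
  open Ops K

  mapBasis : ∀ {X Y : Set} → (X → Y) → Lin X → Lin Y
  mapBasis h = map (map₂ h)

  mapBasis-scale : ∀ {Y Z : Set} (h : Y → Z) a (u : Lin Y) → mapBasis h (scale a u) ≡ scale a (mapBasis h u)
  mapBasis-scale h a u = ≡.trans (≡.sym (map-∘ u)) (map-∘ u)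

  mapBasis-ext : ∀ {X Y Z : Set} (h : Y → Z) (f : X → Lin Y) u → mapBasis h (ext f u) ≡ ext (mapBasis h ∘ f) u
  mapBasis-ext h f [] = ≡.refl
  mapBasis-ext h f ((a , x) ∷ u) =
    ≡.trans (map-++ (map₂ h) (scale a (f x)) (ext f u))
            (cong₂ _++_ (mapBasis-scale h a (f x)) (mapBasis-ext h f u))

  ext-mapBasis : ∀ {X Y Z : Set} (f : Y → Lin Z) (h : X → Y) u → ext f (mapBasis h u) ≡ ext (f ∘ h) u
  ext-mapBasis f h [] = ≡.refl
  ext-mapBasis f h ((a , x) ∷ u) = cong (scale a (f (h x)) ++_) (ext-mapBasis f h u)

  ext-cong : ∀ {X Y : Set} {f g : X → Lin Y} → (∀ x → f x ≡ g x) → ∀ u → ext f u ≡ ext g u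
  ext-cong f≗g [] = ≡.refl
  ext-cong f≗g ((a , x) ∷ u) = cong₂ (λ w w' → scale a w ++ w') (f≗g x) (ext-cong f≗g u)

  mapBasis-bil : ∀ {X Y Z X' Y' Z' : Set} {f : X → Y → Z} {f' : X' → Y' → Z'}
                 (h : Z → Z') (h₁ : X → X') (h₂ : Y → Y') →
                 (∀ x y → h (f x y) ≡ f' (h₁ x) (h₂ y)) →
                 ∀ u v → mapBasis h (bil f u v) ≡ bil f' (mapBasis h₁ u) (mapBasis h₂ v)
  mapBasis-bil h h₁ h₂ h-hom u v =
    ≡.trans (mapBasis-ext h _ u)
      (≡.trans (ext-cong (λ x → ≡.trans (mapBasis-ext h _ v)
                   (≡.trans (ext-cong (λ y → cong single (h-hom x y)) v)
                            (≡.sym (ext-mapBasis _ h₂ v)))) u)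
        (≡.sym (ext-mapBasis _ h₁ u)))

-- Word bialgebras with isomorphic generators

module LetterRenaming {c ℓ} (K : CommutativeRing c ℓ) {G₁ G₂ : Setoid 0ℓ 0ℓ}
                      (letters : Inverse G₁ G₂) where
  open CommutativeRing K
  open Ops K
  open Rebasing K
  open Inverse letters
  module A = WordBialg K G₁
  module B = WordBialg K G₂
  module ∼A = FreeMod K A.WordS
  module ∼B = FreeMod K B.WordS
  module ∼B² = FreeMod K B.Word²S
  module B² = FreeModProperties K B.Word²S

  rename : A.Word → B.Word
  rename = map to

  rename² : A.Word × A.Word → B.Word × B.Word
  rename² (u , v) = rename u , rename v

  rename-cong : ∀ {w w'} → Setoid._≈_ A.WordS w w' → Setoid._≈_ B.WordS (rename w) (rename w')
  rename-cong = Pointwise.map⁺ to to ∘ Pointwise.map to-cong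

  unrename-cong : ∀ {w w'} → Setoid._≈_ B.WordS w w' → Setoid._≈_ A.WordS (map from w) (map from w')
  unrename-cong = Pointwise.map⁺ from from ∘ Pointwise.map from-cong

  unrename-rename : ∀ w → Setoid._≈_ A.WordS (map from (rename w)) w
  unrename-rename [] = Pointwise.[]
  unrename-rename (x ∷ w) = strictlyInverseʳ x Pointwise.∷ unrename-rename w

  rename-unrename : ∀ w → Setoid._≈_ B.WordS (rename (map from w)) w
  rename-unrename [] = Pointwise.[]
  rename-unrename (y ∷ w) = strictlyInverseˡ y Pointwise.∷ rename-unrename w

  _++²_ : ∀ {X : Set} → List X × List X → List X × List X → List X × List X
  (u , v) ++² (u' , v') = u ++ u' , v ++ v'

  rename²-++² : ∀ p q → rename² (p ++² q) ≡ rename² p ++² rename² q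
  rename²-++² (u , v) (u' , v') = cong₂ _,_ (map-++ to u u') (map-++ to v v')

  ++²-cong : ∀ {p p' q q'} → Setoid._≈_ B.Word²S p p' → Setoid._≈_ B.Word²S q q' →
             Setoid._≈_ B.Word²S (p ++² q) (p' ++² q')
  ++²-cong (u≋u' , v≋v') (w≋w' , x≋x') = Pointwise.++⁺ u≋u' w≋w' , Pointwise.++⁺ v≋v' x≋x'

  module _ (δ₁ : A.Coproduct) (δ₂ : B.Coproduct)
           (δ-compat : ∀ g → mapBasis rename² (δ₁ g) ∼B².∼ δ₂ (to g)) where
    open import Relation.Binary.Reasoning.Setoid B².∼-setoid

    Δ-compat : ∀ w → mapBasis rename² (A.Δ δ₁ w) ∼B².∼ B.Δ δ₂ (rename w)
    Δ-compat [] = ∼B².∼refl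
    Δ-compat (g ∷ w) = begin
      mapBasis rename² (A.mul⊗ (δ₁ g) (A.Δ δ₁ w))
        ≡⟨ mapBasis-bil rename² rename² rename² rename²-++² (δ₁ g) (A.Δ δ₁ w) ⟩
      B.mul⊗ (mapBasis rename² (δ₁ g)) (mapBasis rename² (A.Δ δ₁ w))
        ≈⟨ BilinearExtension.bil-cong K B.Word²S B.Word²S B.Word²S ++²-cong (δ-compat g) (Δ-compat w) ⟩
      B.mul⊗ (δ₂ (to g)) (B.Δ δ₂ (rename w)) ∎

    φ : A.Word → Lin B.Word
    φ = single ∘ rename

    φ⊗φ-basis : ∀ u → ext (λ p → bil _,_ (φ (proj₁ p)) (φ (proj₂ p))) u ∼B².∼ mapBasis rename² u
    φ⊗φ-basis [] = ∼B².∼refl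
    φ⊗φ-basis ((a , _) ∷ u) =
      B².∼-prep (trans (*-congˡ (trans (*-identityˡ _) (*-identityˡ _))) (*-identityʳ a)) (φ⊗φ-basis u)

    φ-Δ : ∀ w → ext (λ p → bil _,_ (φ (proj₁ p)) (φ (proj₂ p))) (A.Δ δ₁ w) ∼B².∼ ext (B.Δ δ₂) (φ w)
    φ-Δ w = begin
      ext (λ p → bil _,_ (φ (proj₁ p)) (φ (proj₂ p))) (A.Δ δ₁ w) ≈⟨ φ⊗φ-basis (A.Δ δ₁ w) ⟩
      mapBasis rename² (A.Δ δ₁ w)                               ≈⟨ Δ-compat w ⟩
      B.Δ δ₂ (rename w)                                         ≈⟨ B².scale-identityˡ _ ⟨
      scale 1# (B.Δ δ₂ (rename w))                              ≡⟨ ++-identityʳ _ ⟨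
      ext (B.Δ δ₂) (φ w)                                        ∎

    φ-ε : ∀ w → eval B.ε (φ w) ≈ A.ε w
    φ-ε [] = trans (+-identityʳ _) (*-identityˡ _)
    φ-ε (_ ∷ _) = trans (+-identityʳ _) (*-identityˡ _)

    bialgIso : BialgIso K G₁ δ₁ G₂ δ₂
    bialgIso = record
      { φ = φ
      ; ψ = single ∘ map from
      ; φ-resp = single-cong ∘ rename-cong
      ; ψ-resp = λ w≋w' → ∼A.∼cons refl (unrename-cong w≋w') ∼A.∼refl
      ; ψ∘φ = λ w → ∼A.∼cons (*-identityˡ _) (unrename-rename w) ∼A.∼refl
      ; φ∘ψ = λ w → ∼B.∼cons (*-identityˡ _) (rename-unrename w) ∼B.∼refl
      ; φ-unit = ∼B.∼refl
      ; φ-mul = λ w w' → ∼B.∼cons (sym (trans (*-identityˡ _) (*-identityˡ _)))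
                           (Setoid.reflexive B.WordS (map-++ to w w')) ∼B.∼refl
      ; φ-Δ = φ-Δ
      ; φ-ε = φ-ε
      }
      where open FreeModProperties K B.WordS using (single-cong)

-- The monoid MAs_S is ℕ^s

open import Data.Nat using (_+_)

infixl 6 _+ᵛ_
_+ᵛ_ : ∀ {n} → Vec ℕ n → Vec ℕ n → Vec ℕ n
_+ᵛ_ = zipWith _+_

updateAt-suc-+ᵛ : ∀ {n} (i : Fin n) (u v : Vec ℕ n) →
                  updateAt (u +ᵛ v) i suc ≡ updateAt u i suc +ᵛ v
updateAt-suc-+ᵛ zero (x ∷ u) (y ∷ v) = ≡.refl
updateAt-suc-+ᵛ (suc i) (x ∷ u) (y ∷ v) = cong (x + y ∷_) (updateAt-suc-+ᵛ i u v)

updateAt-self-commutes : ∀ {A : Set} {n} (i j : Fin n) {f : A → A} (xs : Vec A n) →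
                         updateAt (updateAt xs j f) i f ≡ updateAt (updateAt xs i f) j f
updateAt-self-commutes i j xs with i ≟ᶠ j
... | yes ≡.refl = ≡.refl
... | no i≢j = updateAt-commutes i j i≢j xs

relabel : ∀ {s t} → (Fin s → Fin t) → UTree s → UTree t
relabel f leaf = leaf
relabel f (node g t) = node (f g) (relabel f t)

relabel-graft : ∀ {s t} (f : Fin s → Fin t) (x z : UTree s) →
                relabel f (graft x z) ≡ graft (relabel f x) (relabel f z)
relabel-graft f leaf z = ≡.refl
relabel-graft f (node g x) z = cong (node (f g)) (relabel-graft f x z)

relabel-cong : ∀ {s t} (f : Fin s → Fin t) {x y : UTree s} → x ≈M y → relabel f x ≈M relabel f y
relabel-cong f m-refl = m-refl
relabel-cong f (m-sym p) = m-sym (relabel-cong f p)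
relabel-cong f (m-trans p q) = m-trans (relabel-cong f p) (relabel-cong f q)
relabel-cong f (m-comp {x} {x'} {z} {z'} p q)
  rewrite relabel-graft f x z | relabel-graft f x' z' = m-comp (relabel-cong f p) (relabel-cong f q)
relabel-cong f (m-gen g g') = m-gen (f g) (f g')

module _ {s : ℕ} where

  multiplicity : UTree s → Vec ℕ s
  multiplicity leaf = zeroV s
  multiplicity (node g t) = updateAt (multiplicity t) g suc

  multiplicity-graft : ∀ (x z : UTree s) → multiplicity (graft x z) ≡ multiplicity x +ᵛ multiplicity z
  multiplicity-graft leaf z = ≡.sym (zipWith-identityˡ +-identityˡ (multiplicity z))
  multiplicity-graft (node g x) z =
    ≡.trans (cong (λ v → updateAt v g suc) (multiplicity-graft x z))
            (updateAt-suc-+ᵛ g (multiplicity x) (multiplicity z))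

  multiplicity-cong : ∀ {x y : UTree s} → x ≈M y → multiplicity x ≡ multiplicity y
  multiplicity-cong m-refl = ≡.refl
  multiplicity-cong (m-sym p) = ≡.sym (multiplicity-cong p)
  multiplicity-cong (m-trans p q) = ≡.trans (multiplicity-cong p) (multiplicity-cong q)
  multiplicity-cong (m-comp {x} {x'} {z} {z'} p q) =
    ≡.trans (multiplicity-graft x z)
      (≡.trans (cong₂ _+ᵛ_ (multiplicity-cong p) (multiplicity-cong q)) (≡.sym (multiplicity-graft x' z')))
  multiplicity-cong (m-gen g g') = updateAt-self-commutes g g' (zeroV s)

  node-cong : ∀ (g : Fin s) {x y} → x ≈M y → node g x ≈M node g y
  node-cong g = m-comp (m-refl {x = node g leaf})

  node-swap : ∀ (g h : Fin s) t → node g (node h t) ≈M node h (node g t)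
  node-swap g h t = m-comp (m-gen g h) (m-refl {x = t})

multiplicity-relabel-suc : ∀ {s} (t : UTree s) → multiplicity (relabel suc t) ≡ 0 ∷ multiplicity t
multiplicity-relabel-suc leaf = ≡.refl
multiplicity-relabel-suc (node g t) = cong (λ v → updateAt v (suc g) suc) (multiplicity-relabel-suc t)

module _ {s : ℕ} where

  stack₀ : ℕ → UTree (suc s) → UTree (suc s)
  stack₀ zero t = t
  stack₀ (suc n) t = node zero (stack₀ n t)

  stack₀-cong : ∀ n {x y : UTree (suc s)} → x ≈M y → stack₀ n x ≈M stack₀ n y
  stack₀-cong zero p = p
  stack₀-cong (suc n) p = node-cong zero (stack₀-cong n p)

  node-stack₀ : ∀ (g : Fin (suc s)) n t → node g (stack₀ n t) ≈M stack₀ n (node g t)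
  node-stack₀ g zero t = m-refl
  node-stack₀ g (suc n) t = m-trans (node-swap g zero (stack₀ n t)) (node-cong zero (node-stack₀ g n t))

  multiplicity-stack₀ : ∀ n (t : UTree s) → multiplicity (stack₀ n (relabel suc t)) ≡ n ∷ multiplicity t
  multiplicity-stack₀ zero t = multiplicity-relabel-suc t
  multiplicity-stack₀ (suc n) t = cong (λ v → updateAt v zero suc) (multiplicity-stack₀ n t)

-- The normal form of v carries v₁ nodes labelled 1 above v₂ nodes labelled 2, and so on.
normalForm : ∀ {s} → Vec ℕ s → UTree s
normalForm [] = leaf
normalForm (n ∷ v) = stack₀ n (relabel suc (normalForm v))

normalForm-zero : ∀ s → normalForm (zeroV s) ≡ leaf
normalForm-zero zero = ≡.refl
normalForm-zero (suc s) = cong (relabel suc) (normalForm-zero s)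

multiplicity-normalForm : ∀ {s} (v : Vec ℕ s) → multiplicity (normalForm v) ≡ v
multiplicity-normalForm [] = ≡.refl
multiplicity-normalForm (n ∷ v) =
  ≡.trans (multiplicity-stack₀ n (normalForm v)) (cong (n ∷_) (multiplicity-normalForm v))

node-normalForm : ∀ {s} (g : Fin s) v → node g (normalForm v) ≈M normalForm (updateAt v g suc)
node-normalForm zero (n ∷ v) = m-refl
node-normalForm (suc g) (n ∷ v) =
  m-trans (node-stack₀ (suc g) n (relabel suc (normalForm v)))
          (stack₀-cong n (relabel-cong suc (node-normalForm g v)))

module _ {s : ℕ} where

  ≈M-normalForm : ∀ (t : UTree s) → t ≈M normalForm (multiplicity t)
  ≈M-normalForm leaf = Setoid.reflexive (MAs s) (≡.sym (normalForm-zero s))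
  ≈M-normalForm (node g t) = m-trans (node-cong g (≈M-normalForm t)) (node-normalForm g (multiplicity t))

  multiplicity-injective : ∀ {x y : UTree s} → multiplicity x ≡ multiplicity y → x ≈M y
  multiplicity-injective {x} {y} e =
    m-trans (≈M-normalForm x) (subst (λ v → normalForm v ≈M y) (≡.sym e) (m-sym (≈M-normalForm y)))

  normalForm≈M⇒≡multiplicity : ∀ {v : Vec ℕ s} {t} → normalForm v ≈M t → v ≡ multiplicity t
  normalForm≈M⇒≡multiplicity {v} e = ≡.trans (≡.sym (multiplicity-normalForm v)) (multiplicity-cong e)

  normalForm-injective : ∀ {v w : Vec ℕ s} → normalForm v ≈M normalForm w → v ≡ w
  normalForm-injective {w = w} e = ≡.trans (normalForm≈M⇒≡multiplicity e) (multiplicity-normalForm w)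

  multiplicityInverse : Inverse (NGen s) (SGen s)
  multiplicityInverse = record
    { to = λ (t , t≉1) → multiplicity t , t≉1 ∘ multiplicity-injective
    ; from = λ (v , v≢0) → normalForm v , v≢0 ∘ normalForm≈M⇒≡multiplicity
    ; to-cong = multiplicity-cong
    ; from-cong = Setoid.reflexive (MAs s) ∘ cong normalForm
    ; inverse = (λ e → ≡.trans (multiplicity-cong e) (multiplicity-normalForm _))
              , (λ e → multiplicity-injective (≡.trans (multiplicity-normalForm _) e))
    }

splitsN-sound : ∀ {n i j} → (i , j) ∈ splitsN n → i + j ≡ n
splitsN-sound p with _ , k∈ , ≡.refl ← ∈-map⁻ _ p = m+[n∸m]≡n (≤-pred (∈-upTo⁻ k∈))

splitsN-complete : ∀ i j {n} → i + j ≡ n → (i , j) ∈ splitsN n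
splitsN-complete i j ≡.refl =
  subst (λ k → (i , k) ∈ splitsN (i + j)) (m+n∸m≡n i j) (∈-map⁺ _ (∈-upTo⁺ (s≤s (m≤m+n i j))))

splitsN-unique : ∀ n → Unique (splitsN n)
splitsN-unique n = Unique.map⁺ (cong proj₁) (Unique.upTo⁺ (suc n))

consPair : ∀ {s} → ℕ × ℕ → Vec ℕ s × Vec ℕ s → Vec ℕ (suc s) × Vec ℕ (suc s)
consPair (i , j) (a , b) = i ∷ a , j ∷ b

consPair-injective : ∀ {s} {ij kl : ℕ × ℕ} {ab cd : Vec ℕ s × Vec ℕ s} →
                     consPair ij ab ≡ consPair kl cd → ij ≡ kl × ab ≡ cd
consPair-injective e with ∷-injective (cong proj₁ e) | ∷-injective (cong proj₂ e)
... | ≡.refl , ≡.refl | ≡.refl , ≡.refl = ≡.refl , ≡.refl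

concatMap-map≡cartesianProductWith : ∀ {A B C : Set} (f : A → B → C) xs ys →
  concatMap (λ x → map (f x) ys) xs ≡ cartesianProductWith f xs ys
concatMap-map≡cartesianProductWith f [] ys = ≡.refl
concatMap-map≡cartesianProductWith f (x ∷ xs) ys =
  cong (map (f x) ys ++_) (concatMap-map≡cartesianProductWith f xs ys)

splitsV-∷ : ∀ {s} n (v : Vec ℕ s) → splitsV (n ∷ v) ≡ cartesianProductWith consPair (splitsN n) (splitsV v)
splitsV-∷ n v = concatMap-map≡cartesianProductWith consPair (splitsN n) (splitsV v)

splitsV-sound : ∀ {s} (v : Vec ℕ s) {a b} → (a , b) ∈ splitsV v → a +ᵛ b ≡ v
splitsV-sound [] (Any.here ≡.refl) = ≡.refl
splitsV-sound (n ∷ v) p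
  with _ , _ , ij∈ , ab∈ , ≡.refl ← ∈-cartesianProductWith⁻ consPair (splitsN n) (splitsV v)
                                       (subst (_ ∈_) (splitsV-∷ n v) p)
  = cong₂ _∷_ (splitsN-sound ij∈) (splitsV-sound v ab∈)

splitsV-complete : ∀ {s} (a b : Vec ℕ s) {v} → a +ᵛ b ≡ v → (a , b) ∈ splitsV v
splitsV-complete [] [] ≡.refl = Any.here ≡.refl
splitsV-complete (i ∷ a) (j ∷ b) ≡.refl =
  subst ((i ∷ a , j ∷ b) ∈_) (≡.sym (splitsV-∷ (i + j) (a +ᵛ b)))
    (∈-cartesianProductWith⁺ consPair {splitsN (i + j)} {splitsV (a +ᵛ b)}
      (splitsN-complete i j ≡.refl) (splitsV-complete a b ≡.refl))

splitsV-unique : ∀ {s} (v : Vec ℕ s) → Unique (splitsV v)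
splitsV-unique [] = All.[] AllPairs.∷ AllPairs.[]
splitsV-unique (n ∷ v) =
  subst Unique (≡.sym (splitsV-∷ n v))
    (Unique.cartesianProductWith⁺ consPair consPair-injective (splitsN-unique n) (splitsV-unique v))

-- Factorizations in MAs_S

module _ {s : ℕ} where

  normalForm² : Vec ℕ s × Vec ℕ s → UTree s × UTree s
  normalForm² (a , b) = normalForm a , normalForm b

  multiplicity² : UTree s × UTree s → Vec ℕ s × Vec ℕ s
  multiplicity² (y , z) = multiplicity y , multiplicity z

  multiplicity-factor : ∀ (y z : UTree s) {x} → graft y z ≈M x →
                        multiplicity y +ᵛ multiplicity z ≡ multiplicity x
  multiplicity-factor y z yz≈x = ≡.trans (≡.sym (multiplicity-graft y z)) (multiplicity-cong yz≈x)

  graft-normalForm : ∀ (a b : Vec ℕ s) {x} → a +ᵛ b ≡ multiplicity x → graft (normalForm a) (normalForm b) ≈M x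
  graft-normalForm a b e = multiplicity-injective
    (≡.trans (multiplicity-graft (normalForm a) (normalForm b))
      (≡.trans (cong₂ _+ᵛ_ (multiplicity-normalForm a) (multiplicity-normalForm b)) e))

  factorizations : FinitelyFactorizable s
  factorizations x = record
    { facts = map normalForm² (splitsV (multiplicity x))
    ; sound = All.tabulate sound
    ; complete = λ y z yz≈x →
        Any.map (λ { ≡.refl → ≈M-normalForm y , ≈M-normalForm z })
          (∈-map⁺ normalForm² (splitsV-complete (multiplicity y) (multiplicity z) (multiplicity-factor y z yz≈x)))
    ; distinct = AllPairs.map⁺ (AllPairs.map
        (λ ab≢cd (a≈c , b≈d) → ab≢cd (cong₂ _,_ (normalForm-injective a≈c) (normalForm-injective b≈d)))
        (splitsV-unique (multiplicity x)))
    }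
    where
    sound : ∀ {p} → p ∈ map normalForm² (splitsV (multiplicity x)) → graft (proj₁ p) (proj₂ p) ≈M x
    sound p∈ with (a , b) , ab∈ , ≡.refl ← ∈-map⁻ normalForm² p∈ =
      graft-normalForm a b (splitsV-sound (multiplicity x) ab∈)

  -- Both lists are duplicate-free and have the same members, hence are permutations of each other.
  facts↭splitsV : ∀ {x : UTree s} (F : FactEnum x) →
                  map multiplicity² (FactEnum.facts F) ↭ splitsV (multiplicity x)
  facts↭splitsV {x} F = ∼bag⇒↭ (unique∧set⇒bag facts-unique (splitsV-unique (multiplicity x)) (mk⇔ to from))
    where
    open FactEnum F
    facts-unique : Unique (map multiplicity² facts)
    facts-unique = AllPairs.map⁺ (AllPairs.map
      (λ p≉q e → p≉q (multiplicity-injective (cong proj₁ e) , multiplicity-injective (cong proj₂ e)))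
      distinct)
    to : ∀ {p} → p ∈ map multiplicity² facts → p ∈ splitsV (multiplicity x)
    to p∈ with (y , z) , yz∈ , ≡.refl ← ∈-map⁻ multiplicity² p∈ =
      splitsV-complete (multiplicity y) (multiplicity z) (multiplicity-factor y z (All.lookup sound yz∈))
    from : ∀ {p} → p ∈ splitsV (multiplicity x) → p ∈ map multiplicity² facts
    from {a , b} ab∈ = Any.map⁺ (Any.map
      (λ (a≈ , b≈) → cong₂ _,_ (normalForm≈M⇒≡multiplicity a≈) (normalForm≈M⇒≡multiplicity b≈))
      (complete (normalForm a) (normalForm b) (graft-normalForm a b (splitsV-sound (multiplicity x) ab∈))))

-- The coproducts correspond

module _ {c ℓ} (K : CommutativeRing c ℓ) (s : ℕ) (fac : FinitelyFactorizable s) where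
  open CommutativeRing K using (Carrier; 1#; refl)
  open Rebasing K
  open LetterRenaming K (multiplicityInverse {s})
  open Inverse (multiplicityInverse {s}) using (to)
  open FreeMod K B.Word²S
  open FreeModProperties K B.Word²S using (∼-setoid; ↭⇒∼)
  open import Relation.Binary.Reasoning.Setoid ∼-setoid

  rename-rdM : ∀ (y : UTree s) → Setoid._≈_ B.WordS (rename (rdM y)) (rdV (multiplicity y))
  rename-rdM leaf with ≡-dec _≟_ (zeroV s) (zeroV s)
  ... | yes _ = Pointwise.[]
  ... | no 0≢0 = ⊥-elim (0≢0 ≡.refl)
  rename-rdM (node g t) with ≡-dec _≟_ (multiplicity (node g t)) (zeroV s)
  ... | yes m≡0 = ⊥-elim (node≉leaf (multiplicity-injective {x = node g t} m≡0))
  ... | no _ = ≡.refl Pointwise.∷ Pointwise.[]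

  termN : UTree s × UTree s → Carrier × (A.Word × A.Word)
  termN (y , z) = 1# , (rdM y , rdM z)

  termS : Vec ℕ s × Vec ℕ s → Carrier × (B.Word × B.Word)
  termS (a , b) = 1# , (rdV a , rdV b)

  rename-terms : ∀ ps → mapBasis rename² (map termN ps) ∼ map termS (map multiplicity² ps)
  rename-terms [] = ∼refl
  rename-terms ((y , z) ∷ ps) = ∼cons refl (rename-rdM y , rename-rdM z) (rename-terms ps)

  δN-compat : ∀ g → mapBasis rename² (δN K s fac g) ∼ δS K s (to g)
  δN-compat (x , _) = begin
    mapBasis rename² (map termN (FactEnum.facts (fac x)))   ≈⟨ rename-terms (FactEnum.facts (fac x)) ⟩
    map termS (map multiplicity² (FactEnum.facts (fac x)))  ≈⟨ ↭⇒∼ (↭.map⁺ termS (facts↭splitsV (fac x))) ⟩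
    map termS (splitsV (multiplicity x))                    ∎

mainTheorem8 : ∀ {c ℓ} (K : CommutativeRing c ℓ) → IsField K → CharZero K →
    (s : ℕ) →
    FinitelyFactorizable s ×
      ((fac : FinitelyFactorizable s) →
        BialgIso K (NGen s) (δN K s fac) (SGen s) (δS K s))
mainTheorem8 K _ _ s =
  factorizations , λ fac →
    LetterRenaming.bialgIso K multiplicityInverse (δN K s fac) (δS K s) (δN-compat K s fac)
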